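{- The $\Pi^0_1$ bar induction ${\rm \Pi^0_1\text{ - }BI}$ implies ${\rm LLPO}$.
   Context: Work in Bishop-style constructive mathematics (no excluded middle); "implies" means derivable over this base. Notation: $\mathbb{N}^*$ finite sequences of naturals, $a*b$ concatenation, $\langle\rangle$ empty sequence, $\langle n\rangle$ one-element sequence, $\overline{\alpha}n$ initial segment of length $n$. A predicate $P\subseteq\mathbb{N}^*$ is a bar if $(\forall\alpha\in\mathbb{N}^{\mathbb{N}})(\exists n)P(\overline{\alpha}n)$; it is a $\Pi^0_1$-set if there is a detachable (decidable) $D\subseteq\mathbb{N}^*\times\mathbb{N}$ with $P(a)\leftrightarrow(\forall n)D(a,n)$ for all $a$. $Q\subseteq\mathbb{N}^*$ is inductive if $(\forall a)[(\forall n)Q(a*\langle n\rangle)\to Q(a)]$. ${\rm \Pi^0_1\text{ - }BI}$: for every bar $P$ that is a $\Pi^0_1$-set and every $Q\subseteq\mathbb{N}^*$, if $P\subseteq Q$ and $Q$ is inductive then $Q(\langle\rangle)$. ${\rm LLPO}$: for all $\alpha,\beta\in\mathbb{N}^{\mathbb{N}}$, if $\neg[(\exists n)\alpha(n)\neq0\wedge(\exists n)\beta(n)\neq0]$ then $\neg(\exists n)\alpha(n)\neq0\vee\neg(\exists n)\beta(n)\neq0$. -}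

module Defs where

open import Data.Nat using (ℕ)
open import Data.List using (List; []; [_]; _++_)
open import Data.Product using (Σ; ∃; _×_)
open import Data.Empty using (⊥)
open import Data.Sum using (_⊎_)
open import Relation.Nullary using (¬_; Dec)
open import Relation.Unary using (Decidable)
open import Relation.Binary.PropositionalEquality using (_≢_)

-- Finite sequences ℕ* are lists of naturals; a * b is list append,
-- ⟨⟩ is [], ⟨ n ⟩ is [ n ].
Seq : Set
Seq = List ℕ

Baire : Set
Baire = ℕ → ℕ

initSeg : Baire → ℕ → Seq
initSeg α ℕ.zero    = []
initSeg α (ℕ.suc n) = initSeg α n ++ [ α n ]

IsBar : (Seq → Set) → Set
IsBar P = (α : Baire) → ∃ λ n → P (initSeg α n)

IsΠ01 : (Seq → Set) → Set₁
IsΠ01 P = Σ (Seq → ℕ → Set) λ D →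
  ((a : Seq) (n : ℕ) → Dec (D a n)) ×
  ((a : Seq) → (P a → (n : ℕ) → D a n) × (((n : ℕ) → D a n) → P a))

IsInductive : (Seq → Set) → Set
IsInductive Q = (a : Seq) → ((n : ℕ) → Q (a ++ [ n ])) → Q a

Π01-BI : Set₁
Π01-BI = (P Q : Seq → Set) → IsBar P → IsΠ01 P →
  ((a : Seq) → P a → Q a) → IsInductive Q → Q []

NonZeroSomewhere : Baire → Set
NonZeroSomewhere α = ∃ λ n → α n ≢ 0

LLPO : Set
LLPO = (α β : Baire) → ¬ (NonZeroSomewhere α × NonZeroSomewhere β) →
  ¬ NonZeroSomewhere α ⊎ ¬ NonZeroSomewhere β

-- The tree of finite sequences is barred by the
-- Π⁰₁-set P consisting of
--   ⟨c+1⟩                 (always),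
--   ⟨0⟩                   when α is identically zero,
--   ⟨0, j⟩                when β j = 0.
-- It is a bar because, for the path through ⟨0, j⟩, either β j = 0 or
-- β j ≠ 0, and in the latter case the hypothesis forces α to vanish.
-- The inductive predicate Q assigns the LLPO disjunction to ⟨⟩ and ⟨0⟩,
-- "β j = 0" to sequences starting with 0, j, and ⊤ to those starting with
-- c+1.  At ⟨0⟩ the two clauses meet: membership in P gives the left
-- disjunct, inductivity (β j = 0 for every j) gives the right one.
-- Bar induction then yields Q ⟨⟩, which is the required disjunction.
module Submission where

open import Defs
open import Data.Nat using (ℕ; zero; suc; _≟_)
open import Data.List using ([]; _∷_)
open import Data.Product using (_×_; _,_)
open import Data.Empty using (⊥; ⊥-elim)
open import Data.Unit using (⊤; tt)
open import Data.Sum using (_⊎_; inj₁; inj₂)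
open import Relation.Nullary using (¬_; Dec; yes; no)
open import Relation.Binary.PropositionalEquality using (_≡_)

pointwise-Π01 : (D : Seq → ℕ → Set) → ((a : Seq) (n : ℕ) → Dec (D a n)) →
                IsΠ01 (λ a → (n : ℕ) → D a n)
pointwise-Π01 D D? = D , D? , λ a → (λ p → p) , (λ p → p)

vanishing⇒¬nonzero : (α : Baire) → ((m : ℕ) → α m ≡ 0) → ¬ NonZeroSomewhere α
vanishing⇒¬nonzero α zero-at (m , αm≢0) = αm≢0 (zero-at m)

-- If α and β are not both somewhere nonzero and β is nonzero at j, then α
-- vanishes everywhere; equality on ℕ being decidable makes this constructive.
vanishes-beside : (α β : Baire) → ¬ (NonZeroSomewhere α × NonZeroSomewhere β) →
                  (j : ℕ) → ¬ β j ≡ 0 → (m : ℕ) → α m ≡ 0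
vanishes-beside α β not-both j βj≢0 m with α m ≟ 0
... | yes αm≡0 = αm≡0
... | no αm≢0  = ⊥-elim (not-both ((m , αm≢0) , (j , βj≢0)))

module LLPO-Tree (α β : Baire)
                 (not-both : ¬ (NonZeroSomewhere α × NonZeroSomewhere β)) where

  D : Seq → ℕ → Set
  D (suc _ ∷ [])     _ = ⊤
  D (zero ∷ [])      m = α m ≡ 0
  D (zero ∷ j ∷ [])  _ = β j ≡ 0
  D _                _ = ⊥

  D? : (a : Seq) (m : ℕ) → Dec (D a m)
  D? (suc _ ∷ [])          _ = yes tt
  D? (zero ∷ [])           m = α m ≟ 0
  D? (zero ∷ j ∷ [])       _ = β j ≟ 0
  D? []                    _ = no λ ()
  D? (suc _ ∷ _ ∷ _)       _ = no λ ()
  D? (zero ∷ _ ∷ _ ∷ _)    _ = no λ ()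

  P : Seq → Set
  P a = (m : ℕ) → D a m

  barred : (x y : ℕ) → P (x ∷ []) ⊎ P (x ∷ y ∷ [])
  barred (suc _) _ = inj₁ λ _ → tt
  barred zero    y with β y ≟ 0
  ... | yes βy≡0 = inj₂ λ _ → βy≡0
  ... | no βy≢0  = inj₁ (vanishes-beside α β not-both y βy≢0)

  P-bar : IsBar P
  P-bar γ with barred (γ 0) (γ 1)
  ... | inj₁ p = 1 , p
  ... | inj₂ p = 2 , p

  Goal : Set
  Goal = ¬ NonZeroSomewhere α ⊎ ¬ NonZeroSomewhere β

  Q : Seq → Set
  Q []             = Goal
  Q (zero ∷ [])    = Goal
  Q (zero ∷ j ∷ _) = β j ≡ 0
  Q (suc _ ∷ _)    = ⊤

  P⊆Q : (a : Seq) → P a → Q a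
  P⊆Q (suc _ ∷ _)          _ = tt
  P⊆Q (zero ∷ [])          p = inj₁ (vanishing⇒¬nonzero α p)
  P⊆Q (zero ∷ j ∷ [])      p = p 0
  P⊆Q []                   p = ⊥-elim (p 0)
  P⊆Q (zero ∷ _ ∷ _ ∷ _)   p = ⊥-elim (p 0)

  Q-inductive : IsInductive Q
  Q-inductive []             Q-succ = Q-succ 0
  Q-inductive (zero ∷ [])    Q-succ = inj₂ (vanishing⇒¬nonzero β Q-succ)
  Q-inductive (zero ∷ _ ∷ _) Q-succ = Q-succ 0
  Q-inductive (suc _ ∷ _)    _      = tt

proposition7p1 : Π01-BI → LLPO
proposition7p1 bar-induction α β not-both =
  bar-induction P Q P-bar (pointwise-Π01 D D?) P⊆Q Q-inductive
  where open LLPO-Tree α β not-both
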